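{- Let $n\ge1$ and integers $k\ge1$, $l\ge0$. Let $\widetilde{\mathfrak{DT}}_n^{(k,l)}=\{T\in\widetilde{\mathfrak{DT}}_n:\mathsf{top}(T)=k,\ \mathsf{iop}(T)=l\}$. Then there exists a bijection $\phi:\widetilde{\mathfrak{DT}}_n^{(k,l)}\to\widetilde{\mathfrak{DT}}_n^{(k-1,l+1)}$ such that for every $T\in\widetilde{\mathfrak{DT}}_n^{(k,l)}$, $$(\mathrm{DESB},\mathrm{LMAX},\mathrm{LMIN})\,\eta^{ -1}(T)=(\mathrm{DESB},\mathrm{LMAX},\mathrm{LMIN})\,\eta^{ -1}(\phi(T)).$$
   Context: For $\pi\in\mathfrak{S}_n$: $\mathrm{LMAX}(\pi)=\{\pi_i:\pi_j<\pi_i\ \forall j<i\}$, $\mathrm{LMIN}(\pi)=\{\pi_i:\pi_j>\pi_i\ \forall j<i\}$, $\mathrm{DESB}(\pi)=\{\pi_{i+1}: i\in[n-1],\ \pi_i>\pi_{i+1}\}$. $\mathfrak{S}_n(2413,3142)$ is the set of permutations of $[n]$ avoiding the patterns $2413$ and $3142$. Direct and skew sums: for $\pi\in\mathfrak{S}_k,\sigma\in\mathfrak{S}_l$, $\pi\oplus\sigma=\pi_1\cdots\pi_k(\sigma_1+k)\cdots(\sigma_l+k)$, $\pi\ominus\sigma=(\pi_1+l)\cdots(\pi_k+l)\sigma_1\cdots\sigma_l$. A di-sk tree is a rooted binary tree (each node has at most one left child and at most one right child) with nodes labeled $\oplus$ or $\ominus$ such that no node has the same label as its right child; $\mathfrak{DT}_n$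 is the set of di-sk trees with $n-1$ nodes. The bijection $\eta:\mathfrak{S}_n(2413,3142)\to\mathfrak{DT}_n$ is defined recursively: $\eta(1)=\emptyset$; for $n\ge2$ let $i$ be the largest index in $[n-1]$ with $\min\{\pi_1,\dots,\pi_i\}>\max\{\pi_{i+1},\dots,\pi_n\}$ or $\max\{\pi_1,\dots,\pi_i\}<\min\{\pi_{i+1},\dots,\pi_n\}$; in the first case $\pi=\omega\ominus\rho$ and $\eta(\pi)$ has root $\ominus$, left subtree $\eta(\omega)$, right subtree $\eta(\rho)$; in the second case $\pi=\omega\oplus\rho$ and $\eta(\pi)$ has root $\oplus$, left subtree $\eta(\omega)$, right subtree $\eta(\rho)$. Inorder traversal: left subtree, root, right subtree (recursively). The spine of a tree is the path from the root to the first node in inorder. $\mathsf{top}(T)$ is the number of consecutive $\oplus$-nodes at the top of the spine starting from the root; $\mathsf{iop}(T)$ is the number of initial $\oplus$-nodes of $T$ in inorder (the number of nodes preceding the first $\ominus$-node in inorder, or the total number of nodes if there is none). $\widetilde{\mathfrak{DT}}_n$ is the set of $T\in\mathfrak{DT}_n$ whose spine contains at least one $\ominus$-node. -}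

module Defs where

open import Data.Nat using (ℕ; zero; suc; _+_; _<_; _>_)
open import Data.Bool using (Bool; true; false; _∧_; _∨_; not)
open import Data.List using (List; []; _∷_; _++_; map; length; lookup)
open import Data.Bool.ListAction using (any)
open import Data.Fin using (Fin; toℕ)
open import Data.Product using (Σ; _×_)
open import Relation.Binary.PropositionalEquality using (_≡_)
open import Function.Bundles using (_⇔_)

-- Permutations (one-line notation, values 1..n) and their statistics

_⊕ₚ_ : List ℕ → List ℕ → List ℕ
π ⊕ₚ σ = π ++ map (λ x → x + length π) σ

_⊖ₚ_ : List ℕ → List ℕ → List ℕ
π ⊖ₚ σ = map (λ x → x + length σ) π ++ σ

LMAX : List ℕ → ℕ → Set
LMAX π x = Σ (Fin (length π)) λ i → lookup π i ≡ x ×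
             ((j : Fin (length π)) → toℕ j < toℕ i → lookup π j < lookup π i)

LMIN : List ℕ → ℕ → Set
LMIN π x = Σ (Fin (length π)) λ i → lookup π i ≡ x ×
             ((j : Fin (length π)) → toℕ j < toℕ i → lookup π j > lookup π i)

DESB : List ℕ → ℕ → Set
DESB π x = Σ (Fin (length π)) λ i → lookup π i ≡ x ×
             Σ (Fin (length π)) λ j → suc (toℕ j) ≡ toℕ i × lookup π j > lookup π i

_≐_ : (ℕ → Set) → (ℕ → Set) → Set
P ≐ Q = (x : ℕ) → P x ⇔ Q x

SameStats : List ℕ → List ℕ → Set
SameStats π σ = (DESB π ≐ DESB σ) × (LMAX π ≐ LMAX σ) × (LMIN π ≐ LMIN σ)

data Label : Set where
  ⊕ ⊖ : Label

_==L_ : Label → Label → Bool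
⊕ ==L ⊕ = true
⊖ ==L ⊖ = true
_ ==L _ = false

isSkew : Label → Bool
isSkew ⊕ = false
isSkew ⊖ = true

data Tree : Set where
  leaf : Tree
  node : Label → Tree → Tree → Tree

size : Tree → ℕ
size leaf = 0
size (node _ L R) = suc (size L + size R)

rightOK : Label → Tree → Bool
rightOK a leaf = true
rightOK a (node b _ _) = not (a ==L b)

isDiSk : Tree → Bool
isDiSk leaf = true
isDiSk (node a L R) = isDiSk L ∧ isDiSk R ∧ rightOK a R

spine : Tree → List Label
spine leaf = []
spine (node a L R) = a ∷ spine L

inorder : Tree → List Label
inorder leaf = []
inorder (node a L R) = inorder L ++ (a ∷ inorder R)

leading⊕ : List Label → ℕ
leading⊕ [] = 0
leading⊕ (⊕ ∷ xs) = suc (leading⊕ xs)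
leading⊕ (⊖ ∷ xs) = 0

top : Tree → ℕ
top T = leading⊕ (spine T)

iop : Tree → ℕ
iop T = leading⊕ (inorder T)

spineHasSkew : Tree → Bool
spineHasSkew T = any isSkew (spine T)

DTt : ℕ → ℕ → ℕ → Set
DTt n k l = Σ Tree λ T → (isDiSk T ≡ true) × (suc (size T) ≡ n) ×
              (spineHasSkew T ≡ true) × (top T ≡ k) × (iop T ≡ l)

-- η⁻¹ : the inverse of η, following its recursive definition
-- (η(ω ⊕ ρ) = ⊕(η ω, η ρ), η(ω ⊖ ρ) = ⊖(η ω, η ρ), η(1) = ∅)

η⁻¹ : Tree → List ℕ
η⁻¹ leaf = 1 ∷ []
η⁻¹ (node ⊕ L R) = η⁻¹ L ⊕ₚ η⁻¹ R
η⁻¹ (node ⊖ L R) = η⁻¹ L ⊖ₚ η⁻¹ R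

-- The statistics (DESB, LMAX, LMIN) of η⁻¹ T can be computed along T from those of
-- the subtrees (lmax, lmin, desb below), and these tree-level data are invariant under
-- associativity of ⊕ and under the exchange (A ⊖ M) ⊕ R ~ (A ⊕ R) ⊖ M. If top T = k ≥ 1, the k-th
-- spine node is a ⊕-node with left child ⊖(A, M) and right subtree R; φ replaces this subtree by
-- ⊖(merge A R, M), where merge A R is a di-sk tree obtained from ⊕(A, R) by those moves and has
-- exactly one more initial ⊕-node in inorder than A. So φ lowers top by one, raises iop by one and
-- keeps the statistics, and split, the inverse of merge, yields the inverse of φ.

module Submission where

open import Defs
open import Axiom.UniquenessOfIdentityProofs using (module Decidable⇒UIP)
open import Data.Bool using (Bool; true; false; _∧_)
open import Data.Bool.Properties using (∧-conicalˡ; ∧-conicalʳ; ∧-zeroʳ) renaming (_≟_ to _≟ᵇ_)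
open import Data.Empty using (⊥-elim)
open import Data.Fin using (Fin; toℕ) renaming (zero to fzero; suc to fsuc)
open import Data.List using (List; []; _∷_; _++_; map; length; lookup)
open import Data.List.Membership.Propositional using (_∈_)
open import Data.List.Membership.Propositional.Properties using (∈-map⁻; ∈-map⁺; ∈-++⁻)
open import Data.List.Properties
  using (++-assoc; ++-identityʳ; length-++; length-map; length-++-≤ˡ; length-++-≤ʳ)
open import Data.List.Relation.Unary.Any using (here; there)
open import Data.Nat using (ℕ; zero; suc; _+_; _∸_; _<_; _>_; _≤_; s≤s; z≤n; pred)
open import Data.Nat.Properties
  using (+-identityʳ; +-suc; +-assoc; +-comm; +-monoˡ-<; +-cancelʳ-<; +-monoˡ-≤; <-asym; ≤-<-trans;
         ≤-trans; ≤-refl; m≤m+n; suc-injective; ≡-irrelevant; module ≤-Reasoning)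
open import Data.Nat.Tactic.RingSolver using (solve-∀)
open import Data.Product using (Σ; _×_; _,_; proj₁; proj₂; ∃-syntax; map₁; uncurry)
open import Data.Sum using (_⊎_; inj₁; inj₂; assocʳ; assocˡ) renaming (map to map⊎)
open import Function using (_∘_; case_of_)
open import Function.Bundles using (_⤖_; Bijection; mk↔ₛ′; mk⇔)
open import Function.Properties.Inverse using (↔⇒⤖)
open import Level using (0ℓ)
open import Relation.Binary.Bundles using (Setoid)
open import Relation.Binary.Definitions using (Asymmetric)
open import Relation.Binary.PropositionalEquality
  using (_≡_; _≢_; refl; sym; trans; cong; cong₂; subst; module ≡-Reasoning)
import Relation.Binary.Reasoning.Setoid as SetoidReasoning
open import Relation.Binary.Structures using (IsEquivalence)
open import Relation.Unary using (Pred; _∪_; _≐′_; ∅; ｛_｝)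
open import Relation.Unary.Properties using (≐′-refl; ≐′-sym; ≐′-trans)

data DiSk : Tree → Set where
  leaf : DiSk leaf
  node : ∀ {a L R} → DiSk L → DiSk R → rightOK a R ≡ true → DiSk (node a L R)

isDiSk⇒DiSk : ∀ T → isDiSk T ≡ true → DiSk T
isDiSk⇒DiSk leaf _ = leaf
isDiSk⇒DiSk (node a L R) e =
  node (isDiSk⇒DiSk L (∧-conicalˡ _ _ e)) (isDiSk⇒DiSk R (∧-conicalˡ _ _ e′)) (∧-conicalʳ _ _ e′)
  where e′ = ∧-conicalʳ (isDiSk L) _ e

DiSk⇒isDiSk : ∀ {T} → DiSk T → isDiSk T ≡ true
DiSk⇒isDiSk leaf = refl
DiSk⇒isDiSk (node dL dR ok) rewrite DiSk⇒isDiSk dL | DiSk⇒isDiSk dR = ok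

data SkewSpine : Tree → Set where
  ⊖-root : ∀ {L R} → SkewSpine (node ⊖ L R)
  ⊕-left : ∀ {L R} → SkewSpine L → SkewSpine (node ⊕ L R)

spineHasSkew⇒SkewSpine : ∀ T → spineHasSkew T ≡ true → SkewSpine T
spineHasSkew⇒SkewSpine (node ⊖ L R) _ = ⊖-root
spineHasSkew⇒SkewSpine (node ⊕ L R) e = ⊕-left (spineHasSkew⇒SkewSpine L e)

SkewSpine⇒spineHasSkew : ∀ {T} → SkewSpine T → spineHasSkew T ≡ true
SkewSpine⇒spineHasSkew ⊖-root = refl
SkewSpine⇒spineHasSkew (⊕-left s) = SkewSpine⇒spineHasSkew s

all⊕ : Tree → Bool
all⊕ leaf = true
all⊕ (node ⊕ L R) = all⊕ L ∧ all⊕ R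
all⊕ (node ⊖ L R) = false

SkewSpine⇒¬all⊕ : ∀ {T} → SkewSpine T → all⊕ T ≡ false
SkewSpine⇒¬all⊕ ⊖-root = refl
SkewSpine⇒¬all⊕ (⊕-left s) rewrite SkewSpine⇒¬all⊕ s = refl

-- Here and below, an auxiliary function with a leading Bool or ℕ argument receives all⊕ or iop′ of
-- a subtree from its caller, so that proofs can evaluate it by rewriting with that value.
iop′ : Tree → ℕ
iop⊕′ : Bool → Tree → Tree → ℕ
iop′ leaf = 0
iop′ (node ⊕ L R) = iop⊕′ (all⊕ L) L R
iop′ (node ⊖ L R) = iop′ L
iop⊕′ true L R = suc (size L + iop′ R)
iop⊕′ false L R = iop′ L

iop′-all⊕ : ∀ T → all⊕ T ≡ true → iop′ T ≡ size T
iop′-all⊕ leaf _ = refl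
iop′-all⊕ (node ⊕ L R) e with all⊕ L | all⊕ R in eR
... | true | true = cong (λ m → suc (size L + m)) (iop′-all⊕ R eR)

iop′-⊕-skew : ∀ {L} R → SkewSpine L → iop′ (node ⊕ L R) ≡ iop′ L
iop′-⊕-skew R s rewrite SkewSpine⇒¬all⊕ s = refl

leading⊕-all⊕ : ∀ T ys → all⊕ T ≡ true → leading⊕ (inorder T ++ ys) ≡ size T + leading⊕ ys
leading⊕-all⊕ leaf ys _ = refl
leading⊕-all⊕ (node ⊕ L R) ys e with all⊕ L in eL | all⊕ R in eR
... | true | true = begin
  leading⊕ ((inorder L ++ ⊕ ∷ inorder R) ++ ys)  ≡⟨ cong leading⊕ (++-assoc (inorder L) _ ys) ⟩
  leading⊕ (inorder L ++ ⊕ ∷ (inorder R ++ ys))  ≡⟨ leading⊕-all⊕ L _ eL ⟩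
  size L + suc (leading⊕ (inorder R ++ ys))      ≡⟨ cong (λ m → size L + suc m) (leading⊕-all⊕ R ys eR) ⟩
  size L + suc (size R + leading⊕ ys)            ≡⟨ +-suc (size L) _ ⟩
  suc (size L + (size R + leading⊕ ys))          ≡⟨ cong suc (+-assoc (size L) _ _) ⟨
  suc (size L + size R + leading⊕ ys)            ∎
  where open ≡-Reasoning

leading⊕-¬all⊕ : ∀ T ys → all⊕ T ≡ false → leading⊕ (inorder T ++ ys) ≡ iop′ T
leading⊕-¬all⊕ (node ⊖ L R) ys e rewrite ++-assoc (inorder L) (⊖ ∷ inorder R) ys with all⊕ L in eL
... | true  = trans (leading⊕-all⊕ L _ eL) (trans (+-identityʳ _) (sym (iop′-all⊕ L eL)))
... | false = leading⊕-¬all⊕ L _ eL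
leading⊕-¬all⊕ (node ⊕ L R) ys e rewrite ++-assoc (inorder L) (⊕ ∷ inorder R) ys with all⊕ L in eL
... | false = leading⊕-¬all⊕ L _ eL
... | true  = trans (leading⊕-all⊕ L _ eL)
                (trans (cong (λ m → size L + suc m) (leading⊕-¬all⊕ R ys e)) (+-suc (size L) _))

iop≡iop′ : ∀ T → iop T ≡ iop′ T
iop≡iop′ T with all⊕ T in e
... | true  = begin
  leading⊕ (inorder T)        ≡⟨ cong leading⊕ (++-identityʳ (inorder T)) ⟨
  leading⊕ (inorder T ++ [])  ≡⟨ leading⊕-all⊕ T [] e ⟩
  size T + 0                  ≡⟨ +-identityʳ (size T) ⟩
  size T                      ≡⟨ iop′-all⊕ T e ⟨
  iop′ T                      ∎
  where open ≡-Reasoning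
... | false = trans (cong leading⊕ (sym (++-identityʳ (inorder T)))) (leading⊕-¬all⊕ T [] e)

-- merge and split

push⊖ : Tree → Tree → Tree
push⊖ leaf M = node ⊖ leaf M
push⊖ (node ⊖ S₁ S₂) M = node ⊖ (push⊖ S₁ S₂) M
push⊖ (node ⊕ S₁ S₂) M = node ⊕ (push⊖ S₁ M) S₂

pop⊖ : Tree → Tree × Tree
pop⊖ leaf = leaf , leaf
pop⊖ (node ⊖ leaf M) = leaf , M
pop⊖ (node ⊖ L M) = uncurry (node ⊖) (pop⊖ L) , M
pop⊖ (node ⊕ L R) = map₁ (λ S → node ⊕ S R) (pop⊖ L)

all⊕-push⊖ : ∀ S M → all⊕ (push⊖ S M) ≡ false
all⊕-push⊖ leaf M = refl
all⊕-push⊖ (node ⊖ S₁ S₂) M = refl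
all⊕-push⊖ (node ⊕ S₁ S₂) M rewrite all⊕-push⊖ S₁ M = refl

iop′-push⊖ : ∀ S M → iop′ (push⊖ S M) ≡ 0
iop′-push⊖ leaf M = refl
iop′-push⊖ (node ⊖ S₁ S₂) M = iop′-push⊖ S₁ S₂
iop′-push⊖ (node ⊕ S₁ S₂) M rewrite all⊕-push⊖ S₁ M = iop′-push⊖ S₁ M

DiSk-push⊖ : ∀ S M → DiSk (node ⊖ S M) → DiSk (push⊖ S M)
DiSk-push⊖ leaf M d = d
DiSk-push⊖ (node ⊖ S₁ S₂) M (node (node dS₁ dS₂ ok₂) dM okM) =
  node (DiSk-push⊖ S₁ S₂ (node dS₁ dS₂ ok₂)) dM okM
DiSk-push⊖ (node ⊕ S₁ S₂) M (node (node dS₁ dS₂ ok₂) dM okM) =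
  node (DiSk-push⊖ S₁ M (node dS₁ dM okM)) dS₂ ok₂

pop⊖-push⊖ : ∀ S M → pop⊖ (push⊖ S M) ≡ (S , M)
pop⊖-push⊖ leaf M = refl
pop⊖-push⊖ (node ⊖ leaf S₂) M = refl
pop⊖-push⊖ (node ⊖ S₁@(node ⊖ _ _) S₂) M rewrite pop⊖-push⊖ S₁ S₂ = refl
pop⊖-push⊖ (node ⊖ (node ⊕ S₁ _) S₂) M rewrite pop⊖-push⊖ S₁ S₂ = refl
pop⊖-push⊖ (node ⊕ S₁ S₂) M rewrite pop⊖-push⊖ S₁ M = refl

push⊖-pop⊖ : ∀ a L R → DiSk (node a L R) → iop′ (node a L R) ≡ 0 →
  DiSk (uncurry (node ⊖) (pop⊖ (node a L R))) × uncurry push⊖ (pop⊖ (node a L R)) ≡ node a L R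
push⊖-pop⊖ ⊖ leaf M d _ = d , refl
push⊖-pop⊖ ⊖ (node a L R) M (node dL dM okM) i with push⊖-pop⊖ a L R dL i
... | dS , eq = node dS dM okM , cong (λ S → node ⊖ S M) eq
push⊖-pop⊖ ⊕ (node a L R) T (node dL dT okT) i with all⊕ (node a L R)
... | false with push⊖-pop⊖ a L R dL i
...   | node dS₁ dS₂ ok₂ , eq = node (node dS₁ dT okT) dS₂ ok₂ , cong (λ S → node ⊕ S T) eq

graft : Tree → Tree → Tree → Tree
graft A (node ⊕ S₁ S₂) M = node ⊕ (graft A S₁ M) S₂
graft A S M = node ⊕ A (push⊖ S M)

mergeAll⊕ : Tree → Tree → Tree
mergeAll⊕ A (node ⊖ S M) = graft A S M
mergeAll⊕ A R = node ⊕ A R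

-- merge is only used on di-sk trees ⊕(A, R), where the last clauses of merge′ and merge⊕
-- never apply.
merge : Tree → Tree → Tree
merge′ : Bool → Tree → Tree → Tree
merge⊕ : Bool → Tree → Tree → Tree → Tree
merge A R = merge′ (all⊕ A) A R
merge′ true A R = mergeAll⊕ A R
merge′ false (node ⊖ A₁ A₂) R = node ⊖ (merge A₁ R) A₂
merge′ false (node ⊕ A₁ A₂) R = merge⊕ (all⊕ A₁) A₁ A₂ R
merge′ false leaf R = node ⊕ leaf R
merge⊕ false A₁ A₂ R = node ⊕ (merge A₁ A₂) R
merge⊕ true A₁ (node ⊖ C D) R = node ⊕ A₁ (node ⊖ (merge C R) D)
merge⊕ true A₁ A₂ R = node ⊕ (node ⊕ A₁ A₂) R

merge-all⊕ : ∀ A R → all⊕ A ≡ true → merge A R ≡ mergeAll⊕ A R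
merge-all⊕ A R e = cong (λ b → merge′ b A R) e

merge-¬all⊕ : ∀ A R → all⊕ A ≡ false → merge A R ≡ merge′ false A R
merge-¬all⊕ A R e = cong (λ b → merge′ b A R) e

-- split is only used on di-sk trees with iop′ ≢ 0, where split leaf and split⊕ˡ true _ leaf _
-- never apply.
split : Tree → Tree × Tree
split⊕ : Bool → Tree → Tree → Tree × Tree
split⊕ˡ : Bool → Tree → Tree → Tree → Tree × Tree
split⊕ʳ : ℕ → Tree → Tree → Tree → Tree × Tree
split leaf = leaf , leaf
split (node ⊖ X₁ X₂) = map₁ (λ A → node ⊖ A X₂) (split X₁)
split (node ⊕ X₁ X₂) = split⊕ (all⊕ X₁) X₁ X₂
split⊕ false X₁ X₂ = split⊕ˡ (all⊕ (proj₁ (split X₁))) (proj₁ (split X₁)) (proj₂ (split X₁)) X₂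
split⊕ true X₁ (node ⊖ Y W) = split⊕ʳ (iop′ Y) X₁ Y W
split⊕ true X₁ X₂ = X₁ , X₂
split⊕ˡ true A (node ⊖ S M) X₂ = A , node ⊖ (node ⊕ S X₂) M
split⊕ˡ _ A B X₂ = node ⊕ A B , X₂
split⊕ʳ zero X₁ Y W = X₁ , uncurry (node ⊖) (pop⊖ (node ⊖ Y W))
split⊕ʳ (suc _) X₁ Y W = node ⊕ X₁ (node ⊖ (proj₁ (split Y)) W) , proj₂ (split Y)

all⊕-graft : ∀ A S M → all⊕ (graft A S M) ≡ false
all⊕-graft A (node ⊕ S₁ S₂) M rewrite all⊕-graft A S₁ M = refl
all⊕-graft A leaf M = ∧-zeroʳ (all⊕ A)
all⊕-graft A (node ⊖ S₁ S₂) M = ∧-zeroʳ (all⊕ A)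

all⊕-merge : ∀ A R → all⊕ A ≡ false → all⊕ (merge A R) ≡ false
all⊕-merge′ : ∀ A R → all⊕ A ≡ false → all⊕ (merge′ false A R) ≡ false
all⊕-merge⊕ : ∀ b A₁ A₂ R → all⊕ A₁ ≡ b → all⊕ (node ⊕ A₁ A₂) ≡ false →
  all⊕ (merge⊕ b A₁ A₂ R) ≡ false
all⊕-merge A R e rewrite e = all⊕-merge′ A R e
all⊕-merge′ (node ⊖ A₁ A₂) R e = refl
all⊕-merge′ (node ⊕ A₁ A₂) R e = all⊕-merge⊕ (all⊕ A₁) A₁ A₂ R refl e
all⊕-merge⊕ false A₁ A₂ R e₁ e rewrite all⊕-merge A₁ A₂ e₁ = refl
all⊕-merge⊕ true A₁ (node ⊖ C D) R e₁ e = ∧-zeroʳ (all⊕ A₁)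
all⊕-merge⊕ true A₁ leaf R e₁ e rewrite e = refl
all⊕-merge⊕ true A₁ (node ⊕ _ _) R e₁ e rewrite e = refl

iop′-graft : ∀ A S M → all⊕ A ≡ true → iop′ (graft A S M) ≡ suc (size A)
iop′-graft A (node ⊕ S₁ S₂) M e rewrite all⊕-graft A S₁ M = iop′-graft A S₁ M e
iop′-graft A leaf M e rewrite e = cong suc (+-identityʳ _)
iop′-graft A (node ⊖ S₁ S₂) M e rewrite e | iop′-push⊖ S₁ S₂ = cong suc (+-identityʳ _)

iop′-mergeAll⊕ : ∀ A R → all⊕ A ≡ true → rightOK ⊕ R ≡ true → iop′ (mergeAll⊕ A R) ≡ suc (size A)
iop′-mergeAll⊕ A leaf e _ rewrite e = cong suc (+-identityʳ _)
iop′-mergeAll⊕ A (node ⊖ S M) e _ = iop′-graft A S M e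

iop′-merge : ∀ A R → DiSk (node ⊕ A R) → iop′ (merge A R) ≡ suc (iop′ A)
iop′-merge′ : ∀ A R → all⊕ A ≡ false → DiSk (node ⊕ A R) → iop′ (merge′ false A R) ≡ suc (iop′ A)
iop′-merge⊕ : ∀ b A₁ A₂ R → all⊕ A₁ ≡ b → all⊕ (node ⊕ A₁ A₂) ≡ false →
  DiSk (node ⊕ (node ⊕ A₁ A₂) R) → iop′ (merge⊕ b A₁ A₂ R) ≡ suc (iop′ (node ⊕ A₁ A₂))
iop′-merge A R d@(node _ _ ok) with all⊕ A in e
... | true  = trans (iop′-mergeAll⊕ A R e ok) (cong suc (sym (iop′-all⊕ A e)))
... | false = iop′-merge′ A R e d
iop′-merge′ (node ⊖ A₁ A₂) R e (node (node dA₁ _ _) dR ok) = iop′-merge A₁ R (node dA₁ dR ok)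
iop′-merge′ (node ⊕ A₁ A₂) R e d = iop′-merge⊕ (all⊕ A₁) A₁ A₂ R refl e d
iop′-merge⊕ false A₁ A₂ R e₁ e (node dA _ _) rewrite all⊕-merge A₁ A₂ e₁ =
  trans (iop′-merge A₁ A₂ dA) (cong (λ b → suc (iop⊕′ b A₁ A₂)) (sym e₁))
iop′-merge⊕ true A₁ (node ⊖ C D) R e₁ e (node (node _ (node dC _ _) _) dR ok)
  rewrite e₁ | iop′-merge C R (node dC dR ok) = cong suc (+-suc (size A₁) (iop′ C))
iop′-merge⊕ true A₁ leaf R e₁ e d with all⊕ A₁ | e₁ | e
... | .true | refl | ()

DiSk-graft : ∀ A S M → DiSk A → DiSk (node ⊖ S M) → DiSk (graft A S M)
DiSk-graft A (node ⊕ S₁ S₂) M dA (node (node dS₁ dS₂ ok₂) dM ok) =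
  node (DiSk-graft A S₁ M dA (node dS₁ dM ok)) dS₂ ok₂
DiSk-graft A leaf M dA d = node dA (DiSk-push⊖ leaf M d) refl
DiSk-graft A (node ⊖ S₁ S₂) M dA d = node dA (DiSk-push⊖ (node ⊖ S₁ S₂) M d) refl

DiSk-merge : ∀ A R → DiSk (node ⊕ A R) → DiSk (merge A R)
DiSk-merge′ : ∀ A R → DiSk (node ⊕ A R) → DiSk (merge′ false A R)
DiSk-merge⊕ : ∀ b A₁ A₂ R → DiSk (node ⊕ (node ⊕ A₁ A₂) R) → DiSk (merge⊕ b A₁ A₂ R)
DiSk-merge A R d with all⊕ A
DiSk-merge A (node ⊖ S M) (node dA dR _) | true = DiSk-graft A S M dA dR
DiSk-merge A leaf d | true = d
... | false = DiSk-merge′ A R d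
DiSk-merge′ leaf R d = d
DiSk-merge′ (node ⊖ A₁ A₂) R (node (node dA₁ dA₂ ok₂) dR ok) =
  node (DiSk-merge A₁ R (node dA₁ dR ok)) dA₂ ok₂
DiSk-merge′ (node ⊕ A₁ A₂) R d = DiSk-merge⊕ (all⊕ A₁) A₁ A₂ R d
DiSk-merge⊕ false A₁ A₂ R (node dA dR ok) = node (DiSk-merge A₁ A₂ dA) dR ok
DiSk-merge⊕ true A₁ (node ⊖ C D) R (node (node dA₁ (node dC dD okD) _) dR ok) =
  node dA₁ (node (DiSk-merge C R (node dC dR ok)) dD okD) refl
DiSk-merge⊕ true A₁ leaf R d = d
DiSk-merge⊕ true A₁ (node ⊕ _ _) R d = d

split-graft : ∀ A S M → all⊕ A ≡ true → split (graft A S M) ≡ (A , node ⊖ S M)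
split-graft A (node ⊕ S₁ S₂) M e rewrite all⊕-graft A S₁ M | split-graft A S₁ M e | e = refl
split-graft A leaf M e rewrite e = refl
split-graft A (node ⊖ S₁ S₂) M e rewrite e | iop′-push⊖ S₁ S₂ | pop⊖-push⊖ (node ⊖ S₁ S₂) M = refl

split-merge : ∀ A R → DiSk (node ⊕ A R) → split (merge A R) ≡ (A , R)
split-merge′ : ∀ A R → all⊕ A ≡ false → DiSk (node ⊕ A R) → split (merge′ false A R) ≡ (A , R)
split-merge⊕ : ∀ b A₁ A₂ R → all⊕ A₁ ≡ b → all⊕ (node ⊕ A₁ A₂) ≡ false →
  DiSk (node ⊕ (node ⊕ A₁ A₂) R) → split (merge⊕ b A₁ A₂ R) ≡ (node ⊕ A₁ A₂ , R)
split-merge A R d with all⊕ A in e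
split-merge A leaf d | true rewrite e = refl
split-merge A (node ⊖ S M) d | true = split-graft A S M e
split-merge A (node ⊕ _ _) (node _ _ ()) | true
... | false = split-merge′ A R e d
split-merge′ (node ⊖ A₁ A₂) R e (node (node dA₁ _ _) dR ok)
  rewrite split-merge A₁ R (node dA₁ dR ok) = refl
split-merge′ (node ⊕ A₁ A₂) R e d = split-merge⊕ (all⊕ A₁) A₁ A₂ R refl e d
split-merge⊕ false A₁ A₂ R e₁ e (node dA _ _)
  rewrite all⊕-merge A₁ A₂ e₁ | split-merge A₁ A₂ dA | e₁ = refl
split-merge⊕ true A₁ (node ⊖ C D) R e₁ e (node (node _ (node dC _ _) _) dR ok)
  rewrite e₁ | iop′-merge C R (node dC dR ok) | split-merge C R (node dC dR ok) = refl
split-merge⊕ true A₁ leaf R e₁ e d with all⊕ A₁ | e₁ | e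
... | .true | refl | ()

_MergesTo_ : Tree × Tree → Tree → Set
(A , R) MergesTo X = DiSk (node ⊕ A R) × merge A R ≡ X

merge-split : ∀ X → DiSk X → iop′ X ≢ 0 → split X MergesTo X
merge-split⊕ˡ : ∀ b A B {X₁} X₂ → all⊕ A ≡ b → (A , B) MergesTo X₁ → all⊕ X₁ ≡ false →
  DiSk X₂ → rightOK ⊕ X₂ ≡ true → split⊕ˡ b A B X₂ MergesTo node ⊕ X₁ X₂
merge-split⊕ʳ : ∀ X₁ Y W → all⊕ X₁ ≡ true → DiSk (node ⊕ X₁ (node ⊖ Y W)) →
  split⊕ʳ (iop′ Y) X₁ Y W MergesTo node ⊕ X₁ (node ⊖ Y W)
merge-split leaf d i = ⊥-elim (i refl)
merge-split (node ⊖ X₁ X₂) (node d₁ d₂ ok) i with merge-split X₁ d₁ i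
... | node dA dR okR , eq = node (node dA d₂ ok) dR okR , cong (λ Y → node ⊖ Y X₂) eq
merge-split (node ⊕ X₁ X₂) (node d₁ d₂ ok) i with all⊕ X₁ in e₁
... | false = merge-split⊕ˡ _ _ _ X₂ refl (merge-split X₁ d₁ i) e₁ d₂ ok
merge-split (node ⊕ X₁ leaf) d i | true = d , merge-all⊕ X₁ leaf e₁
merge-split (node ⊕ X₁ (node ⊖ Y W)) d i | true = merge-split⊕ʳ X₁ Y W e₁ d
merge-split⊕ˡ true A leaf {X₁} X₂ eA (_ , eq) e₁ _ _ = case all⊕X₁ of λ ()
  where
  all⊕X₁ : true ≡ false
  all⊕X₁ = begin
    true                 ≡⟨ cong (_∧ true) eA ⟨
    all⊕ A ∧ true        ≡⟨ cong all⊕ (merge-all⊕ A leaf eA) ⟨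
    all⊕ (merge A leaf)  ≡⟨ cong all⊕ eq ⟩
    all⊕ X₁              ≡⟨ e₁ ⟩
    false                ∎
    where open ≡-Reasoning
merge-split⊕ˡ true A (node ⊖ S M) X₂ eA (node dA (node dS dM okM) _ , eq) _ d₂ ok =
  node dA (node (node dS d₂ ok) dM okM) refl ,
  trans (merge-all⊕ A _ eA) (cong (λ Y → node ⊕ Y X₂) (trans (sym (merge-all⊕ A _ eA)) eq))
merge-split⊕ˡ false A B {X₁} X₂ eA (dAB , eq) _ d₂ ok = node dAB d₂ ok , (begin
  merge (node ⊕ A B) X₂            ≡⟨ merge-¬all⊕ (node ⊕ A B) X₂ (cong (_∧ all⊕ B) eA) ⟩
  merge⊕ (all⊕ A) A B X₂           ≡⟨ cong (λ b → merge⊕ b A B X₂) eA ⟩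
  node ⊕ (merge A B) X₂            ≡⟨ cong (λ Y → node ⊕ Y X₂) eq ⟩
  node ⊕ X₁ X₂                     ∎)
  where open ≡-Reasoning
merge-split⊕ʳ X₁ Y W e (node dX₁ (node dY dW okW) _) with iop′ Y in eY
... | suc _ with merge-split Y dY (λ i → case trans (sym eY) i of λ ())
...   | node dA dR okR , eq = node (node dX₁ (node dA dW okW) refl) dR okR , (begin
  merge (node ⊕ X₁ (node ⊖ A W)) R    ≡⟨ merge-¬all⊕ (node ⊕ X₁ (node ⊖ A W)) R (cong (_∧ false) e) ⟩
  merge⊕ (all⊕ X₁) X₁ (node ⊖ A W) R  ≡⟨ cong (λ b → merge⊕ b X₁ (node ⊖ A W) R) e ⟩
  node ⊕ X₁ (node ⊖ (merge A R) W)    ≡⟨ cong (λ Y → node ⊕ X₁ (node ⊖ Y W)) eq ⟩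
  node ⊕ X₁ (node ⊖ Y W)              ∎)
  where
  open ≡-Reasoning
  A = proj₁ (split Y)
  R = proj₂ (split Y)
merge-split⊕ʳ X₁ leaf W e d | zero = d , merge-all⊕ X₁ _ e
merge-split⊕ʳ X₁ (node a L R) W e (node dX₁ (node dY dW okW) _) | zero with push⊖-pop⊖ a L R dY eY
... | dS , eq = node dX₁ (node dS dW okW) refl ,
  trans (merge-all⊕ X₁ _ e) (cong (λ Y → node ⊕ X₁ (node ⊖ Y W)) eq)

-- The map φ

φ : Tree → Tree
φ (node ⊕ (node ⊖ A M) R) = node ⊖ (merge A R) M
φ (node ⊕ L R) = node ⊕ (φ L) R
φ T = T

φ⁻¹ : Tree → Tree
φ⁻¹ (node ⊖ X M) = node ⊕ (node ⊖ (proj₁ (split X)) M) (proj₂ (split X))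
φ⁻¹ (node ⊕ L R) = node ⊕ (φ⁻¹ L) R
φ⁻¹ leaf = leaf

SkewSpine-φ : ∀ {T} → SkewSpine T → SkewSpine (φ T)
SkewSpine-φ ⊖-root = ⊖-root
SkewSpine-φ (⊕-left ⊖-root) = ⊖-root
SkewSpine-φ (⊕-left (⊕-left s)) = ⊕-left (SkewSpine-φ (⊕-left s))

top-φ : ∀ {T} → SkewSpine T → top (φ T) ≡ pred (top T)
top-φ ⊖-root = refl
top-φ (⊕-left ⊖-root) = refl
top-φ (⊕-left (⊕-left s)) = cong suc (top-φ (⊕-left s))

DiSk-φ : ∀ {T} → SkewSpine T → DiSk T → DiSk (φ T)
DiSk-φ ⊖-root d = d
DiSk-φ (⊕-left ⊖-root) (node (node dA dM okM) dR ok) = node (DiSk-merge _ _ (node dA dR ok)) dM okM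
DiSk-φ (⊕-left (⊕-left s)) (node dL dR ok) = node (DiSk-φ (⊕-left s) dL) dR ok

iop′-φ : ∀ {T} → SkewSpine T → DiSk T → top T ≢ 0 → iop′ (φ T) ≡ suc (iop′ T)
iop′-φ ⊖-root _ t = ⊥-elim (t refl)
iop′-φ (⊕-left ⊖-root) (node (node dA dM okM) dR ok) _ = iop′-merge _ _ (node dA dR ok)
iop′-φ {node ⊕ T R} (⊕-left (⊕-left s)) (node dT _ _) _ = begin
  iop′ (node ⊕ (φ T) R)    ≡⟨ iop′-⊕-skew R (SkewSpine-φ (⊕-left s)) ⟩
  iop′ (φ T)               ≡⟨ iop′-φ (⊕-left s) dT (λ ()) ⟩
  suc (iop′ T)             ≡⟨ cong suc (iop′-⊕-skew R (⊕-left s)) ⟨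
  suc (iop′ (node ⊕ T R))  ∎
  where open ≡-Reasoning

φ⁻¹-φ : ∀ {T} → SkewSpine T → DiSk T → top T ≢ 0 → φ⁻¹ (φ T) ≡ T
φ⁻¹-φ ⊖-root _ t = ⊥-elim (t refl)
φ⁻¹-φ (⊕-left ⊖-root) (node (node dA dM okM) dR ok) _ rewrite split-merge _ _ (node dA dR ok) = refl
φ⁻¹-φ {node ⊕ T R} (⊕-left (⊕-left s)) (node dT _ _) _ =
  cong (λ L → node ⊕ L R) (φ⁻¹-φ (⊕-left s) dT (λ ()))

SkewSpine-φ⁻¹ : ∀ {T} → SkewSpine T → SkewSpine (φ⁻¹ T)
SkewSpine-φ⁻¹ ⊖-root = ⊕-left ⊖-root
SkewSpine-φ⁻¹ (⊕-left s) = ⊕-left (SkewSpine-φ⁻¹ s)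

top-φ⁻¹ : ∀ {T} → SkewSpine T → top (φ⁻¹ T) ≡ suc (top T)
top-φ⁻¹ ⊖-root = refl
top-φ⁻¹ (⊕-left s) = cong suc (top-φ⁻¹ s)

DiSk-φ⁻¹ : ∀ {T} → SkewSpine T → DiSk T → iop′ T ≢ 0 → DiSk (φ⁻¹ T)
DiSk-φ⁻¹ ⊖-root (node dX dM okM) i with merge-split _ dX i
... | node dA dR ok , _ = node (node dA dM okM) dR ok
DiSk-φ⁻¹ (⊕-left s) (node dL dR ok) i = node (DiSk-φ⁻¹ s dL (i ∘ trans (iop′-⊕-skew _ s))) dR ok

iop′-φ⁻¹ : ∀ {T} → SkewSpine T → DiSk T → iop′ T ≢ 0 → iop′ T ≡ suc (iop′ (φ⁻¹ T))
iop′-φ⁻¹ ⊖-root (node dX _ _) i with merge-split _ dX i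
... | d , eq = trans (cong iop′ (sym eq)) (iop′-merge _ _ d)
iop′-φ⁻¹ {node ⊕ L R} (⊕-left s) (node dL _ _) i = begin
  iop′ (node ⊕ L R)              ≡⟨ iop′-⊕-skew R s ⟩
  iop′ L                         ≡⟨ iop′-φ⁻¹ s dL (i ∘ trans (iop′-⊕-skew R s)) ⟩
  suc (iop′ (φ⁻¹ L))             ≡⟨ cong suc (iop′-⊕-skew R (SkewSpine-φ⁻¹ s)) ⟨
  suc (iop′ (node ⊕ (φ⁻¹ L) R))  ∎
  where open ≡-Reasoning

φ-φ⁻¹ : ∀ {T} → SkewSpine T → DiSk T → iop′ T ≢ 0 → φ (φ⁻¹ T) ≡ T
φ-φ⁻¹ {node ⊖ X M} ⊖-root (node dX _ _) i = cong (λ Y → node ⊖ Y M) (proj₂ (merge-split X dX i))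
φ-φ⁻¹ {node ⊕ L R} (⊕-left ⊖-root) (node dL _ _) i = cong (λ Y → node ⊕ Y R) (φ-φ⁻¹ ⊖-root dL i)
φ-φ⁻¹ {node ⊕ L R} (⊕-left s@(⊕-left _)) (node dL _ _) i =
  cong (λ Y → node ⊕ Y R) (φ-φ⁻¹ s dL (i ∘ trans (iop′-⊕-skew R s)))

-- Statistics along the tree

infixl 7 _↑_

_↑_ : Pred ℕ 0ℓ → ℕ → Pred ℕ 0ℓ
(P ↑ c) x = ∃[ y ] P y × x ≡ y + c

↑-cong : ∀ {P Q c d} → P ≐′ Q → c ≡ d → P ↑ c ≐′ Q ↑ d
↑-cong (P⊆Q , Q⊆P) refl =
  (λ { x (y , p , e) → y , P⊆Q y p , e }) , (λ { x (y , q , e) → y , Q⊆P y q , e })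

∪-cong : ∀ {P P′ Q Q′ : Pred ℕ 0ℓ} → P ≐′ P′ → Q ≐′ Q′ → P ∪ Q ≐′ P′ ∪ Q′
∪-cong (P⊆P′ , P′⊆P) (Q⊆Q′ , Q′⊆Q) =
  (λ x → map⊎ (P⊆P′ x) (Q⊆Q′ x)) , (λ x → map⊎ (P′⊆P x) (Q′⊆Q x))

∪-assoc : ∀ {P Q R : Pred ℕ 0ℓ} → (P ∪ Q) ∪ R ≐′ P ∪ Q ∪ R
∪-assoc = (λ _ → assocʳ) , (λ _ → assocˡ)

∪-swapʳ : ∀ {P Q R : Pred ℕ 0ℓ} → (P ∪ Q) ∪ R ≐′ (P ∪ R) ∪ Q
∪-swapʳ = (λ _ → swap) , (λ _ → swap)
  where
  swap : ∀ {A B C : Set} → (A ⊎ B) ⊎ C → (A ⊎ C) ⊎ B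
  swap (inj₁ (inj₁ a)) = inj₁ (inj₁ a)
  swap (inj₁ (inj₂ b)) = inj₂ b
  swap (inj₂ c) = inj₁ (inj₂ c)

↑-∪-↑ : ∀ {P Q a b c} → c ≡ a + b → (P ∪ Q ↑ a) ↑ b ≐′ P ↑ b ∪ Q ↑ c
↑-∪-↑ {P} {Q} {a} {b} refl = to , from
  where
  to : ∀ x → ((P ∪ Q ↑ a) ↑ b) x → (P ↑ b ∪ Q ↑ (a + b)) x
  to x (y , inj₁ p , e) = inj₁ (y , p , e)
  to x (y , inj₂ (z , q , refl) , e) = inj₂ (z , q , trans e (+-assoc z a b))
  from : ∀ x → (P ↑ b ∪ Q ↑ (a + b)) x → ((P ∪ Q ↑ a) ↑ b) x
  from x (inj₁ (y , p , e)) = y , inj₁ p , e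
  from x (inj₂ (z , q , e)) = z + a , inj₂ (z , q , refl) , trans e (sym (+-assoc z a b))

-- LMAX, LMIN and DESB of η⁻¹ T computed along T; first T is the first entry of η⁻¹ T.
lmax lmin desb : Tree → Pred ℕ 0ℓ
first : Tree → ℕ
lmax leaf = ｛ 1 ｝
lmax (node ⊕ L R) = lmax L ∪ lmax R ↑ suc (size L)
lmax (node ⊖ L R) = lmax L ↑ suc (size R)
lmin leaf = ｛ 1 ｝
lmin (node ⊕ L R) = lmin L
lmin (node ⊖ L R) = lmin L ↑ suc (size R) ∪ lmin R
desb leaf = ∅
desb (node ⊕ L R) = desb L ∪ desb R ↑ suc (size L)
desb (node ⊖ L R) = desb L ↑ suc (size R) ∪ ｛ first R ｝ ∪ desb R
first leaf = 1
first (node ⊕ L R) = first L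
first (node ⊖ L R) = first L + suc (size R)

infix 4 _≈_

record _≈_ (T U : Tree) : Set where
  field
    size≡ : size T ≡ size U
    lmax≐ : lmax T ≐′ lmax U
    lmin≐ : lmin T ≐′ lmin U
    desb≐ : desb T ≐′ desb U

≈-isEquivalence : IsEquivalence _≈_
≈-isEquivalence = record
  { refl = record { size≡ = refl ; lmax≐ = ≐′-refl ; lmin≐ = ≐′-refl ; desb≐ = ≐′-refl }
  ; sym = λ T≈U → let open _≈_ T≈U in record
      { size≡ = sym size≡ ; lmax≐ = ≐′-sym lmax≐ ; lmin≐ = ≐′-sym lmin≐ ; desb≐ = ≐′-sym desb≐ }
  ; trans = λ T≈U U≈W → let open _≈_ in record
      { size≡ = trans (size≡ T≈U) (size≡ U≈W) ; lmax≐ = ≐′-trans (lmax≐ T≈U) (lmax≐ U≈W)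
      ; lmin≐ = ≐′-trans (lmin≐ T≈U) (lmin≐ U≈W) ; desb≐ = ≐′-trans (desb≐ T≈U) (desb≐ U≈W) }
  }

≈-setoid : Setoid 0ℓ 0ℓ
≈-setoid = record { isEquivalence = ≈-isEquivalence }

open IsEquivalence ≈-isEquivalence using () renaming (refl to ≈-refl; sym to ≈-sym)

module ≈-Reasoning = SetoidReasoning ≈-setoid

⊕-congˡ : ∀ {L L′} R → L ≈ L′ → node ⊕ L R ≈ node ⊕ L′ R
⊕-congˡ R L≈L′ = record
  { size≡ = cong (λ n → suc (n + size R)) size≡
  ; lmax≐ = ∪-cong lmax≐ (↑-cong ≐′-refl (cong suc size≡))
  ; lmin≐ = lmin≐
  ; desb≐ = ∪-cong desb≐ (↑-cong ≐′-refl (cong suc size≡))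
  }
  where open _≈_ L≈L′

⊕-congʳ : ∀ L {R R′} → R ≈ R′ → node ⊕ L R ≈ node ⊕ L R′
⊕-congʳ L R≈R′ = record
  { size≡ = cong (λ n → suc (size L + n)) size≡
  ; lmax≐ = ∪-cong ≐′-refl (↑-cong lmax≐ refl)
  ; lmin≐ = ≐′-refl
  ; desb≐ = ∪-cong ≐′-refl (↑-cong desb≐ refl)
  }
  where open _≈_ R≈R′

⊖-congˡ : ∀ {L L′} R → L ≈ L′ → node ⊖ L R ≈ node ⊖ L′ R
⊖-congˡ R L≈L′ = record
  { size≡ = cong (λ n → suc (n + size R)) size≡
  ; lmax≐ = ↑-cong lmax≐ refl
  ; lmin≐ = ∪-cong (↑-cong lmin≐ refl) ≐′-refl
  ; desb≐ = ∪-cong (↑-cong desb≐ refl) ≐′-refl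
  }
  where open _≈_ L≈L′

⊕-assoc : ∀ X Y Z → node ⊕ (node ⊕ X Y) Z ≈ node ⊕ X (node ⊕ Y Z)
⊕-assoc X Y Z = record
  { size≡ = sizes (size X) (size Y) (size Z)
  ; lmax≐ = ≐′-trans ∪-assoc (∪-cong ≐′-refl (≐′-sym (↑-∪-↑ (shifts (size X) (size Y)))))
  ; lmin≐ = ≐′-refl
  ; desb≐ = ≐′-trans ∪-assoc (∪-cong ≐′-refl (≐′-sym (↑-∪-↑ (shifts (size X) (size Y)))))
  }
  where
  sizes : ∀ x y z → suc (suc (x + y) + z) ≡ suc (x + suc (y + z))
  sizes = solve-∀
  shifts : ∀ x y → suc (suc (x + y)) ≡ suc y + suc x
  shifts = solve-∀

-- (A ⊖ M) ⊕ R and (A ⊕ R) ⊖ M differ by swapping the adjacent blocks of M and R, where M lies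
-- below and R above everything before them; this keeps descent bottoms and left-to-right extrema.
⊕⊖-exchange : ∀ A M R → node ⊕ (node ⊖ A M) R ≈ node ⊖ (node ⊕ A R) M
⊕⊖-exchange A M R = record
  { size≡ = sizes (size A) (size M) (size R)
  ; lmax≐ = ≐′-sym (↑-∪-↑ (shifts (size A) (size M)))
  ; lmin≐ = ≐′-refl
  ; desb≐ = ≐′-trans ∪-swapʳ (∪-cong (≐′-sym (↑-∪-↑ (shifts (size A) (size M)))) ≐′-refl)
  }
  where
  sizes : ∀ a m r → suc (suc (a + m) + r) ≡ suc (suc (a + r) + m)
  sizes = solve-∀
  shifts : ∀ a m → suc (suc (a + m)) ≡ suc a + suc m
  shifts = solve-∀

push⊖-≈ : ∀ S M → push⊖ S M ≈ node ⊖ S M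
push⊖-≈ leaf M = ≈-refl
push⊖-≈ (node ⊖ S₁ S₂) M = ⊖-congˡ M (push⊖-≈ S₁ S₂)
push⊖-≈ (node ⊕ S₁ S₂) M = begin
  node ⊕ (push⊖ S₁ M) S₂        ≈⟨ ⊕-congˡ S₂ (push⊖-≈ S₁ M) ⟩
  node ⊕ (node ⊖ S₁ M) S₂       ≈⟨ ⊕⊖-exchange S₁ M S₂ ⟩
  node ⊖ (node ⊕ S₁ S₂) M       ∎
  where open ≈-Reasoning

graft-≈ : ∀ A S M → graft A S M ≈ node ⊕ A (node ⊖ S M)
graft-≈ A (node ⊕ S₁ S₂) M = begin
  node ⊕ (graft A S₁ M) S₂                ≈⟨ ⊕-congˡ S₂ (graft-≈ A S₁ M) ⟩
  node ⊕ (node ⊕ A (node ⊖ S₁ M)) S₂      ≈⟨ ⊕-assoc A (node ⊖ S₁ M) S₂ ⟩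
  node ⊕ A (node ⊕ (node ⊖ S₁ M) S₂)      ≈⟨ ⊕-congʳ A (⊕⊖-exchange S₁ M S₂) ⟩
  node ⊕ A (node ⊖ (node ⊕ S₁ S₂) M)      ∎
  where open ≈-Reasoning
graft-≈ A leaf M = ⊕-congʳ A (push⊖-≈ leaf M)
graft-≈ A (node ⊖ S₁ S₂) M = ⊕-congʳ A (push⊖-≈ (node ⊖ S₁ S₂) M)

merge-≈ : ∀ A R → merge A R ≈ node ⊕ A R
merge′-≈ : ∀ A R → merge′ false A R ≈ node ⊕ A R
merge⊕-≈ : ∀ b A₁ A₂ R → merge⊕ b A₁ A₂ R ≈ node ⊕ (node ⊕ A₁ A₂) R
merge-≈ A R with all⊕ A
merge-≈ A (node ⊖ S M) | true = graft-≈ A S M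
merge-≈ A leaf | true = ≈-refl
merge-≈ A (node ⊕ _ _) | true = ≈-refl
... | false = merge′-≈ A R
merge′-≈ leaf R = ≈-refl
merge′-≈ (node ⊖ A₁ A₂) R = begin
  node ⊖ (merge A₁ R) A₂         ≈⟨ ⊖-congˡ A₂ (merge-≈ A₁ R) ⟩
  node ⊖ (node ⊕ A₁ R) A₂        ≈⟨ ⊕⊖-exchange A₁ A₂ R ⟨
  node ⊕ (node ⊖ A₁ A₂) R        ∎
  where open ≈-Reasoning
merge′-≈ (node ⊕ A₁ A₂) R = merge⊕-≈ (all⊕ A₁) A₁ A₂ R
merge⊕-≈ false A₁ A₂ R = ⊕-congˡ R (merge-≈ A₁ A₂)
merge⊕-≈ true A₁ (node ⊖ C D) R = begin
  node ⊕ A₁ (node ⊖ (merge C R) D)     ≈⟨ ⊕-congʳ A₁ (⊖-congˡ D (merge-≈ C R)) ⟩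
  node ⊕ A₁ (node ⊖ (node ⊕ C R) D)    ≈⟨ ⊕-congʳ A₁ (⊕⊖-exchange C D R) ⟨
  node ⊕ A₁ (node ⊕ (node ⊖ C D) R)    ≈⟨ ⊕-assoc A₁ (node ⊖ C D) R ⟨
  node ⊕ (node ⊕ A₁ (node ⊖ C D)) R    ∎
  where open ≈-Reasoning
merge⊕-≈ true A₁ leaf R = ≈-refl
merge⊕-≈ true A₁ (node ⊕ _ _) R = ≈-refl

φ-≈ : ∀ T → φ T ≈ T
φ-≈ (node ⊕ (node ⊖ A M) R) = begin
  node ⊖ (merge A R) M       ≈⟨ ⊖-congˡ M (merge-≈ A R) ⟩
  node ⊖ (node ⊕ A R) M      ≈⟨ ⊕⊖-exchange A M R ⟨
  node ⊕ (node ⊖ A M) R      ∎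
  where open ≈-Reasoning
φ-≈ (node ⊕ leaf R) = ≈-refl
φ-≈ (node ⊕ L@(node ⊕ _ _) R) = ⊕-congˡ R (φ-≈ L)
φ-≈ (node ⊖ L R) = ≈-refl
φ-≈ leaf = ≈-refl

-- Statistics of sequences

module Records (_⊏_ : ℕ → ℕ → Set) where

  RecordAt : List ℕ → Pred ℕ 0ℓ
  RecordAt π x = Σ (Fin (length π)) λ i → lookup π i ≡ x ×
    ((j : Fin (length π)) → toℕ j < toℕ i → lookup π j ⊏ lookup π i)

  Record : List ℕ → Pred ℕ 0ℓ
  Record [] = ∅
  Record (y ∷ ys) x = x ≡ y ⊎ (y ⊏ x × Record ys x)

  RecordAt≐Record : ∀ π → RecordAt π ≐′ Record π
  RecordAt≐Record π = to π , from π
    where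
    to : ∀ π x → RecordAt π x → Record π x
    to (y ∷ ys) x (fzero , e , _) = inj₁ (sym e)
    to (y ∷ ys) x (fsuc i , e , h) =
      inj₂ (subst (y ⊏_) e (h fzero (s≤s z≤n)) , to ys x (i , e , λ j j<i → h (fsuc j) (s≤s j<i)))
    from : ∀ π x → Record π x → RecordAt π x
    from (y ∷ ys) x (inj₁ refl) = fzero , refl , λ _ ()
    from (y ∷ ys) x (inj₂ (y⊏x , r)) with from ys x r
    ... | i , e , h = fsuc i , e , λ { fzero _ → subst (y ⊏_) (sym e) y⊏x
                                     ; (fsuc j) (s≤s j<i) → h j j<i }

  Record⇒∈ : ∀ π {x} → Record π x → x ∈ π
  Record⇒∈ (y ∷ ys) (inj₁ refl) = here refl
  Record⇒∈ (y ∷ ys) (inj₂ (_ , r)) = there (Record⇒∈ ys r)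

  Record-++⁻ : ∀ p q {x} → Record (p ++ q) x → Record p x ⊎ (∀ {y} → y ∈ p → y ⊏ x) × Record q x
  Record-++⁻ [] q r = inj₂ ((λ ()) , r)
  Record-++⁻ (y ∷ p) q (inj₁ e) = inj₁ (inj₁ e)
  Record-++⁻ (y ∷ p) q (inj₂ (y⊏x , r)) with Record-++⁻ p q r
  ... | inj₁ r′ = inj₁ (inj₂ (y⊏x , r′))
  ... | inj₂ (p⊏x , r′) = inj₂ ((λ { (here refl) → y⊏x ; (there y∈p) → p⊏x y∈p }) , r′)

  Record-++⁺ˡ : ∀ p q {x} → Record p x → Record (p ++ q) x
  Record-++⁺ˡ (y ∷ p) q (inj₁ e) = inj₁ e
  Record-++⁺ˡ (y ∷ p) q (inj₂ (y⊏x , r)) = inj₂ (y⊏x , Record-++⁺ˡ p q r)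

  Record-++⁺ʳ : ∀ p q {x} → (∀ {y} → y ∈ p → y ⊏ x) → Record q x → Record (p ++ q) x
  Record-++⁺ʳ [] q p⊏x r = r
  Record-++⁺ʳ (y ∷ p) q p⊏x r = inj₂ (p⊏x (here refl) , Record-++⁺ʳ p q (λ y∈p → p⊏x (there y∈p)) r)

  Record-shift : ∀ c → (∀ {y z} → y ⊏ z → (y + c) ⊏ (z + c)) →
    (∀ {y z} → (y + c) ⊏ (z + c) → y ⊏ z) → ∀ π → Record (map (_+ c) π) ≐′ Record π ↑ c
  Record-shift c mono cancel π = to π , from π
    where
    to : ∀ π x → Record (map (_+ c) π) x → (Record π ↑ c) x
    to (y ∷ ys) x (inj₁ e) = y , inj₁ refl , e
    to (y ∷ ys) x (inj₂ (lt , r)) with to ys x r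
    ... | z , r′ , refl = z , inj₂ (cancel lt , r′) , refl
    from : ∀ π x → (Record π ↑ c) x → Record (map (_+ c) π) x
    from (y ∷ ys) x (z , inj₁ refl , e) = inj₁ e
    from (y ∷ ys) x (z , inj₂ (lt , r) , refl) = inj₂ (mono lt , from ys x (z , r , refl))

  Record-++-separated : ∀ p q → (∀ {y x} → y ∈ p → x ∈ q → y ⊏ x) →
    Record (p ++ q) ≐′ Record p ∪ Record q
  Record-++-separated p q p⊏q = to , from
    where
    to : ∀ x → Record (p ++ q) x → (Record p ∪ Record q) x
    to x r with Record-++⁻ p q r
    ... | inj₁ r′ = inj₁ r′
    ... | inj₂ (_ , r′) = inj₂ r′
    from : ∀ x → (Record p ∪ Record q) x → Record (p ++ q) x
    from x (inj₁ r) = Record-++⁺ˡ p q r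
    from x (inj₂ r) = Record-++⁺ʳ p q (λ y∈p → p⊏q y∈p (Record⇒∈ q r)) r

  Record-++-dominated : Asymmetric _⊏_ → ∀ p q {y} → y ∈ p → (∀ {x} → x ∈ q → x ⊏ y) →
    Record (p ++ q) ≐′ Record p
  Record-++-dominated asym p q y∈p q⊏y = to , λ x → Record-++⁺ˡ p q
    where
    to : ∀ x → Record (p ++ q) x → Record p x
    to x r with Record-++⁻ p q r
    ... | inj₁ r′ = r′
    ... | inj₂ (p⊏x , r′) = ⊥-elim (asym (p⊏x y∈p) (q⊏y (Record⇒∈ q r′)))

descentAfter : ℕ → List ℕ → Pred ℕ 0ℓ
descentAfter y [] = ∅
descentAfter y (z ∷ _) x = z ≡ x × z < y

Descents : List ℕ → Pred ℕ 0ℓ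
Descents [] = ∅
Descents (y ∷ ys) = descentAfter y ys ∪ Descents ys

DESB≐Descents : ∀ π → DESB π ≐′ Descents π
DESB≐Descents π = to π , from π
  where
  to : ∀ π x → DESB π x → Descents π x
  to (y ∷ z ∷ zs) x (fsuc fzero , e , fzero , refl , z<y) = inj₁ (e , z<y)
  to (y ∷ ys) x (fsuc i , e , fsuc j , j+1≡i , g) =
    inj₂ (to ys x (i , e , j , suc-injective j+1≡i , g))
  from : ∀ π x → Descents π x → DESB π x
  from (y ∷ z ∷ zs) x (inj₁ (e , z<y)) = fsuc fzero , e , fzero , refl , z<y
  from (y ∷ ys) x (inj₂ d) with from ys x d
  ... | i , e , j , j+1≡i , g = fsuc i , e , fsuc j , cong suc j+1≡i , g

Descents-shift : ∀ c π → Descents (map (_+ c) π) ≐′ Descents π ↑ c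
Descents-shift c π = to π , from π
  where
  to : ∀ π x → Descents (map (_+ c) π) x → (Descents π ↑ c) x
  to (y ∷ z ∷ zs) x (inj₁ (e , lt)) = z , inj₁ (refl , +-cancelʳ-< c z y lt) , sym e
  to (y ∷ ys) x (inj₂ d) with to ys x d
  ... | w , d′ , e = w , inj₂ d′ , e
  from : ∀ π x → (Descents π ↑ c) x → Descents (map (_+ c) π) x
  from (y ∷ z ∷ zs) x (.z , inj₁ (refl , lt) , e) = inj₁ (sym e , +-monoˡ-< c lt)
  from (y ∷ ys) x (w , inj₂ d , e) = inj₂ (from ys x (w , d , e))

-- The descent bottom, if any, where p meets q.
junction : List ℕ → List ℕ → Pred ℕ 0ℓ
junction [] q = ∅
junction (y ∷ []) q = descentAfter y q
junction (_ ∷ y ∷ p) q = junction (y ∷ p) q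

Descents-++ : ∀ p q → Descents (p ++ q) ≐′ Descents p ∪ junction p q ∪ Descents q
Descents-++ [] q = (λ _ d → inj₂ (inj₂ d)) , λ { _ (inj₂ (inj₂ d)) → d }
Descents-++ (y ∷ []) q =
  (λ _ → inj₂) , λ { _ (inj₁ (inj₁ ())) ; _ (inj₁ (inj₂ ())) ; _ (inj₂ d) → d }
Descents-++ (y ∷ y′ ∷ p) q = ≐′-trans (∪-cong ≐′-refl (Descents-++ (y′ ∷ p) q)) (≐′-sym ∪-assoc)

junction-∈ : ∀ p q {x} → junction p q x → Σ ℕ λ y → y ∈ p × x ∈ q × x < y
junction-∈ (y ∷ []) (z ∷ zs) (refl , z<y) = y , here refl , here refl , z<y
junction-∈ (_ ∷ y ∷ p) q j with junction-∈ (y ∷ p) q j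
... | w , w∈p , rest = w , there w∈p , rest

junction-head : ∀ p z zs {x} → junction p (z ∷ zs) x → z ≡ x
junction-head (y ∷ []) z zs (e , _) = e
junction-head (_ ∷ y ∷ p) z zs j = junction-head (y ∷ p) z zs j

junction-intro : ∀ p z zs {y} → y ∈ p → (∀ {w} → w ∈ p → z < w) → junction p (z ∷ zs) z
junction-intro (w ∷ []) z zs _ z<p = refl , z<p (here refl)
junction-intro (_ ∷ w ∷ p) z zs _ z<p = junction-intro (w ∷ p) z zs (here refl) (z<p ∘ there)

Descents-++-ascending : ∀ p q → (∀ {y x} → y ∈ p → x ∈ q → y < x) →
  Descents (p ++ q) ≐′ Descents p ∪ Descents q
Descents-++-ascending p q p<q = ≐′-trans (Descents-++ p q) (∪-cong ≐′-refl (to , λ _ → inj₂))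
  where
  to : ∀ x → (junction p q ∪ Descents q) x → Descents q x
  to x (inj₁ j) with junction-∈ p q j
  ... | y , y∈p , x∈q , x<y = ⊥-elim (<-asym x<y (p<q y∈p x∈q))
  to x (inj₂ d) = d

Descents-++-descending : ∀ p q {y z zs} → y ∈ p → (∀ {w x} → w ∈ p → x ∈ q → x < w) → q ≡ z ∷ zs →
  Descents (p ++ q) ≐′ Descents p ∪ ｛ z ｝ ∪ Descents q
Descents-++-descending p q {z = z} {zs} y∈p q<p refl =
  ≐′-trans (Descents-++ p q) (∪-cong ≐′-refl (∪-cong junction≐z ≐′-refl))
  where
  junction≐z : junction p (z ∷ zs) ≐′ ｛ z ｝
  junction≐z = (λ _ → junction-head p z zs) ,
               λ { _ refl → junction-intro p z zs y∈p (λ w∈p → q<p w∈p (here refl)) }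

module LMAX′ = Records _<_
module LMIN′ = Records _>_

LMAX′-shift : ∀ c π → LMAX′.Record (map (_+ c) π) ≐′ LMAX′.Record π ↑ c
LMAX′-shift c = LMAX′.Record-shift c (+-monoˡ-< c) (λ {y z} → +-cancelʳ-< c y z)

LMIN′-shift : ∀ c π → LMIN′.Record (map (_+ c) π) ≐′ LMIN′.Record π ↑ c
LMIN′-shift c = LMIN′.Record-shift c (+-monoˡ-< c) (λ {y z} → +-cancelʳ-< c z y)

length-⊕ₚ : ∀ π σ → length (π ⊕ₚ σ) ≡ length π + length σ
length-⊕ₚ π σ = trans (length-++ π) (cong (length π +_) (length-map _ σ))

length-⊖ₚ : ∀ π σ → length (π ⊖ₚ σ) ≡ length π + length σ
length-⊖ₚ π σ = trans (length-++ (map _ π)) (cong (_+ length σ) (length-map _ π))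

Bounded : List ℕ → Set
Bounded π = ∀ {x} → x ∈ π → 0 < x × x ≤ length π

Bounded-⊕ₚ : ∀ {π σ} → Bounded π → Bounded σ → Bounded (π ⊕ₚ σ)
Bounded-⊕ₚ {π} {σ} bπ bσ x∈ with ∈-++⁻ π x∈
... | inj₁ x∈π = proj₁ (bπ x∈π) , ≤-trans (proj₂ (bπ x∈π)) (length-++-≤ˡ π)
... | inj₂ x∈σ′ with ∈-map⁻ _ x∈σ′
...   | y , y∈σ , refl = ≤-trans (proj₁ (bσ y∈σ)) (m≤m+n y _) , (begin
  y + length π          ≤⟨ +-monoˡ-≤ (length π) (proj₂ (bσ y∈σ)) ⟩
  length σ + length π   ≡⟨ +-comm (length σ) (length π) ⟩
  length π + length σ   ≡⟨ length-⊕ₚ π σ ⟨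
  length (π ⊕ₚ σ)       ∎)
  where open ≤-Reasoning

Bounded-⊖ₚ : ∀ {π σ} → Bounded π → Bounded σ → Bounded (π ⊖ₚ σ)
Bounded-⊖ₚ {π} {σ} bπ bσ x∈ with ∈-++⁻ (map (_+ length σ) π) x∈
... | inj₂ x∈σ = proj₁ (bσ x∈σ) , ≤-trans (proj₂ (bσ x∈σ)) (length-++-≤ʳ σ {map (_+ length σ) π})
... | inj₁ x∈π′ with ∈-map⁻ _ x∈π′
...   | y , y∈π , refl = ≤-trans (proj₁ (bπ y∈π)) (m≤m+n y _) , (begin
  y + length σ          ≤⟨ +-monoˡ-≤ (length σ) (proj₂ (bπ y∈π)) ⟩
  length π + length σ   ≡⟨ length-⊖ₚ π σ ⟨
  length (π ⊖ₚ σ)       ∎)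
  where open ≤-Reasoning

below-shifted : ∀ {π σ x y} → Bounded π → Bounded σ → x ∈ π → y ∈ map (_+ length π) σ → x < y
below-shifted {π} bπ bσ x∈π y∈ with ∈-map⁻ _ y∈
... | z , z∈σ , refl = ≤-<-trans (proj₂ (bπ x∈π)) (+-monoˡ-≤ (length π) (proj₁ (bσ z∈σ)))

module _ {π σ : List ℕ} (bπ : Bounded π) (bσ : Bounded σ) where

  LMAX′-⊕ₚ : LMAX′.Record (π ⊕ₚ σ) ≐′ LMAX′.Record π ∪ LMAX′.Record σ ↑ length π
  LMAX′-⊕ₚ = ≐′-trans (LMAX′.Record-++-separated π _ (below-shifted bπ bσ))
                      (∪-cong ≐′-refl (LMAX′-shift _ σ))

  LMAX′-⊖ₚ : ∀ {y} → y ∈ π → LMAX′.Record (π ⊖ₚ σ) ≐′ LMAX′.Record π ↑ length σ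
  LMAX′-⊖ₚ y∈π =
    ≐′-trans (LMAX′.Record-++-dominated <-asym _ σ y∈π′ (λ x∈σ → below-shifted bσ bπ x∈σ y∈π′))
             (LMAX′-shift _ π)
    where y∈π′ = ∈-map⁺ (_+ length σ) y∈π

  LMIN′-⊕ₚ : ∀ {y} → y ∈ π → LMIN′.Record (π ⊕ₚ σ) ≐′ LMIN′.Record π
  LMIN′-⊕ₚ y∈π = LMIN′.Record-++-dominated <-asym π _ y∈π (below-shifted bπ bσ y∈π)

  LMIN′-⊖ₚ : LMIN′.Record (π ⊖ₚ σ) ≐′ LMIN′.Record π ↑ length σ ∪ LMIN′.Record σ
  LMIN′-⊖ₚ = ≐′-trans (LMIN′.Record-++-separated _ σ (λ y∈π x∈σ → below-shifted bσ bπ x∈σ y∈π))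
                      (∪-cong (LMIN′-shift _ π) ≐′-refl)

  Descents-⊕ₚ : Descents (π ⊕ₚ σ) ≐′ Descents π ∪ Descents σ ↑ length π
  Descents-⊕ₚ = ≐′-trans (Descents-++-ascending π _ (below-shifted bπ bσ))
                         (∪-cong ≐′-refl (Descents-shift _ σ))

  Descents-⊖ₚ : ∀ {y z zs} → y ∈ π → σ ≡ z ∷ zs →
    Descents (π ⊖ₚ σ) ≐′ Descents π ↑ length σ ∪ ｛ z ｝ ∪ Descents σ
  Descents-⊖ₚ y∈π σ≡z∷zs =
    ≐′-trans (Descents-++-descending _ σ (∈-map⁺ (_+ length σ) y∈π)
                                     (λ w∈π x∈σ → below-shifted bσ bπ x∈σ w∈π) σ≡z∷zs)
             (∪-cong (Descents-shift _ π) ≐′-refl)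

length-η⁻¹ : ∀ T → length (η⁻¹ T) ≡ suc (size T)
length-η⁻¹ leaf = refl
length-η⁻¹ (node ⊕ L R) = trans (length-⊕ₚ (η⁻¹ L) (η⁻¹ R))
  (trans (cong₂ _+_ (length-η⁻¹ L) (length-η⁻¹ R)) (cong suc (+-suc _ _)))
length-η⁻¹ (node ⊖ L R) = trans (length-⊖ₚ (η⁻¹ L) (η⁻¹ R))
  (trans (cong₂ _+_ (length-η⁻¹ L) (length-η⁻¹ R)) (cong suc (+-suc _ _)))

η⁻¹-Bounded : ∀ T → Bounded (η⁻¹ T)
η⁻¹-Bounded leaf (here refl) = ≤-refl , ≤-refl
η⁻¹-Bounded (node ⊕ L R) = Bounded-⊕ₚ (η⁻¹-Bounded L) (η⁻¹-Bounded R)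
η⁻¹-Bounded (node ⊖ L R) = Bounded-⊖ₚ (η⁻¹-Bounded L) (η⁻¹-Bounded R)

η⁻¹-first : ∀ T → Σ (List ℕ) λ rest → η⁻¹ T ≡ first T ∷ rest
η⁻¹-first leaf = [] , refl
η⁻¹-first (node ⊕ L R) with η⁻¹-first L
... | rest , eq = rest ++ shiftedR , cong (_++ shiftedR) eq
  where shiftedR = map (_+ length (η⁻¹ L)) (η⁻¹ R)
η⁻¹-first (node ⊖ L R) with η⁻¹-first L
... | rest , eq = map (_+ length (η⁻¹ R)) rest ++ η⁻¹ R ,
  trans (cong (λ π → map (_+ length (η⁻¹ R)) π ++ η⁻¹ R) eq)
        (cong (λ c → first L + c ∷ map (_+ length (η⁻¹ R)) rest ++ η⁻¹ R) (length-η⁻¹ R))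

first∈η⁻¹ : ∀ T → first T ∈ η⁻¹ T
first∈η⁻¹ T = subst (first T ∈_) (sym (proj₂ (η⁻¹-first T))) (here refl)

LMAX′-η⁻¹ : ∀ T → LMAX′.Record (η⁻¹ T) ≐′ lmax T
LMAX′-η⁻¹ leaf = (λ { _ (inj₁ refl) → refl }) , λ { _ refl → inj₁ refl }
LMAX′-η⁻¹ (node ⊕ L R) = ≐′-trans (LMAX′-⊕ₚ (η⁻¹-Bounded L) (η⁻¹-Bounded R))
  (∪-cong (LMAX′-η⁻¹ L) (↑-cong (LMAX′-η⁻¹ R) (length-η⁻¹ L)))
LMAX′-η⁻¹ (node ⊖ L R) = ≐′-trans (LMAX′-⊖ₚ (η⁻¹-Bounded L) (η⁻¹-Bounded R) (first∈η⁻¹ L))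
  (↑-cong (LMAX′-η⁻¹ L) (length-η⁻¹ R))

LMIN′-η⁻¹ : ∀ T → LMIN′.Record (η⁻¹ T) ≐′ lmin T
LMIN′-η⁻¹ leaf = (λ { _ (inj₁ refl) → refl }) , λ { _ refl → inj₁ refl }
LMIN′-η⁻¹ (node ⊕ L R) =
  ≐′-trans (LMIN′-⊕ₚ (η⁻¹-Bounded L) (η⁻¹-Bounded R) (first∈η⁻¹ L)) (LMIN′-η⁻¹ L)
LMIN′-η⁻¹ (node ⊖ L R) = ≐′-trans (LMIN′-⊖ₚ (η⁻¹-Bounded L) (η⁻¹-Bounded R))
  (∪-cong (↑-cong (LMIN′-η⁻¹ L) (length-η⁻¹ R)) (LMIN′-η⁻¹ R))

Descents-η⁻¹ : ∀ T → Descents (η⁻¹ T) ≐′ desb T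
Descents-η⁻¹ leaf = (λ { _ (inj₁ ()) ; _ (inj₂ ()) }) , λ _ ()
Descents-η⁻¹ (node ⊕ L R) = ≐′-trans (Descents-⊕ₚ (η⁻¹-Bounded L) (η⁻¹-Bounded R))
  (∪-cong (Descents-η⁻¹ L) (↑-cong (Descents-η⁻¹ R) (length-η⁻¹ L)))
Descents-η⁻¹ (node ⊖ L R) =
  ≐′-trans (Descents-⊖ₚ (η⁻¹-Bounded L) (η⁻¹-Bounded R) (first∈η⁻¹ L) (proj₂ (η⁻¹-first R)))
    (∪-cong (↑-cong (Descents-η⁻¹ L) (length-η⁻¹ R)) (∪-cong ≐′-refl (Descents-η⁻¹ R)))

LMAX-η⁻¹ : ∀ T → LMAX (η⁻¹ T) ≐′ lmax T
LMAX-η⁻¹ T = ≐′-trans (LMAX′.RecordAt≐Record (η⁻¹ T)) (LMAX′-η⁻¹ T)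

LMIN-η⁻¹ : ∀ T → LMIN (η⁻¹ T) ≐′ lmin T
LMIN-η⁻¹ T = ≐′-trans (LMIN′.RecordAt≐Record (η⁻¹ T)) (LMIN′-η⁻¹ T)

DESB-η⁻¹ : ∀ T → DESB (η⁻¹ T) ≐′ desb T
DESB-η⁻¹ T = ≐′-trans (DESB≐Descents (η⁻¹ T)) (Descents-η⁻¹ T)

≈⇒SameStats : ∀ {T U} → T ≈ U → SameStats (η⁻¹ T) (η⁻¹ U)
≈⇒SameStats {T} {U} T≈U =
  via (DESB-η⁻¹ T) desb≐ (DESB-η⁻¹ U) ,
  via (LMAX-η⁻¹ T) lmax≐ (LMAX-η⁻¹ U) ,
  via (LMIN-η⁻¹ T) lmin≐ (LMIN-η⁻¹ U)
  where
  open _≈_ T≈U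
  via : ∀ {P Q p q : Pred ℕ 0ℓ} → P ≐′ p → p ≐′ q → Q ≐′ q → P ≐ Q
  via P≐p p≐q Q≐q x = mk⇔ (proj₁ P≐Q x) (proj₂ P≐Q x)
    where P≐Q = ≐′-trans P≐p (≐′-trans p≐q (≐′-sym Q≐q))


DTt-≡ : ∀ {n k l} {x y : DTt n k l} → proj₁ x ≡ proj₁ y → x ≡ y
DTt-≡ {x = T , d , s , h , t , i} {.T , d′ , s′ , h′ , t′ , i′} refl
  rewrite Decidable⇒UIP.≡-irrelevant _≟ᵇ_ d d′ | Decidable⇒UIP.≡-irrelevant _≟ᵇ_ h h′
        | ≡-irrelevant s s′ | ≡-irrelevant t t′ | ≡-irrelevant i i′ = refl

DTt-DiSk : ∀ {n k l} (x : DTt n k l) → DiSk (proj₁ x)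
DTt-DiSk (T , d , _) = isDiSk⇒DiSk T d

DTt-SkewSpine : ∀ {n k l} (x : DTt n k l) → SkewSpine (proj₁ x)
DTt-SkewSpine (T , _ , _ , h , _) = spineHasSkew⇒SkewSpine T h

DTt-iop′ : ∀ {n k l} (x : DTt n k l) → iop′ (proj₁ x) ≡ l
DTt-iop′ (T , _ , _ , _ , _ , i) = trans (sym (iop≡iop′ T)) i

module _ {n k l : ℕ} where

  lower : DTt n (suc k) l → DTt n k (l + 1)
  lower x@(T , _ , s , _ , t , _) =
    φ T , DiSk⇒isDiSk (DiSk-φ sk d) , trans (cong suc (_≈_.size≡ (φ-≈ T))) s ,
    SkewSpine⇒spineHasSkew (SkewSpine-φ sk) , trans (top-φ sk) (cong pred t) , iop-φT
    where
    sk = DTt-SkewSpine x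
    d = DTt-DiSk x
    iop-φT : iop (φ T) ≡ l + 1
    iop-φT = begin
      iop (φ T)       ≡⟨ iop≡iop′ (φ T) ⟩
      iop′ (φ T)      ≡⟨ iop′-φ sk d (λ t≡0 → case trans (sym t) t≡0 of λ ()) ⟩
      suc (iop′ T)    ≡⟨ cong suc (DTt-iop′ x) ⟩
      suc l           ≡⟨ +-comm 1 l ⟩
      l + 1           ∎
      where open ≡-Reasoning

  raise : DTt n k (l + 1) → DTt n (suc k) l
  raise y@(T , _ , s , _ , t , _) =
    φ⁻¹ T , DiSk⇒isDiSk (DiSk-φ⁻¹ sk d i≢0) , trans (cong suc size-φ⁻¹T) s ,
    SkewSpine⇒spineHasSkew (SkewSpine-φ⁻¹ sk) , trans (top-φ⁻¹ sk) (cong suc t) , iop-φ⁻¹T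
    where
    sk = DTt-SkewSpine y
    d = DTt-DiSk y
    iop′T : iop′ T ≡ suc l
    iop′T = trans (DTt-iop′ y) (+-comm l 1)
    i≢0 : iop′ T ≢ 0
    i≢0 i≡0 = case trans (sym iop′T) i≡0 of λ ()
    size-φ⁻¹T : size (φ⁻¹ T) ≡ size T
    size-φ⁻¹T = trans (sym (_≈_.size≡ (φ-≈ (φ⁻¹ T)))) (cong size (φ-φ⁻¹ sk d i≢0))
    iop-φ⁻¹T : iop (φ⁻¹ T) ≡ l
    iop-φ⁻¹T = trans (iop≡iop′ (φ⁻¹ T)) (suc-injective (trans (sym (iop′-φ⁻¹ sk d i≢0)) iop′T))

  lower-raise : ∀ y → lower (raise y) ≡ y
  lower-raise y = DTt-≡ (φ-φ⁻¹ (DTt-SkewSpine y) (DTt-DiSk y) i≢0)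
    where
    i≢0 : iop′ (proj₁ y) ≢ 0
    i≢0 i≡0 = case trans (sym (trans (DTt-iop′ y) (+-comm l 1))) i≡0 of λ ()

  raise-lower : ∀ x → raise (lower x) ≡ x
  raise-lower x@(_ , _ , _ , _ , t , _) =
    DTt-≡ (φ⁻¹-φ (DTt-SkewSpine x) (DTt-DiSk x) (λ t≡0 → case trans (sym t) t≡0 of λ ()))

theorem3p2 : (n k l : ℕ) → 1 ≤ n → 1 ≤ k →
    Σ (DTt n k l ⤖ DTt n (k ∸ 1) (l + 1)) λ φ →
    (T : DTt n k l) →
    SameStats (η⁻¹ (proj₁ T)) (η⁻¹ (proj₁ (Bijection.to φ T)))
theorem3p2 n (suc k) l _ (s≤s _) =
  ↔⇒⤖ (mk↔ₛ′ lower raise lower-raise raise-lower) , λ T → ≈⇒SameStats (≈-sym (φ-≈ (proj₁ T)))
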